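{- Let $\mathcal{C}=\{c_1,\ldots,c_m\}$ be a collection of cliques with graph union $U$. The total number of cliques of $U$ of size at least $1$ (nonempty vertex sets inducing a complete graph) is \[ \sum_{\mathcal{F}\in\mathcal{I}_m}\ \prod_{J\in\mathcal{F}}\left[2^{\gamma_J}-1\right], \] where $\mathcal{I}_m$ is the set of all nonempty intersecting families $\mathcal{F}\subseteq\mathcal{P}(\{1,\ldots,m\})$.
   Context: A clique is identified with its vertex set. The graph union $U$ of $c_1,\ldots,c_m$ has vertex set $V=\bigcup_j c_j$, and distinct $u,v\in V$ are adjacent iff $u,v\in c_j$ for some $j$. For $J\subseteq\{1,\ldots,m\}$, $\Gamma_J$ is the set of $v\in V$ with $\{j:v\in c_j\}=J$, and $\gamma_J=|\Gamma_J|$. A family $\mathcal{F}$ of subsets of $\{1,\ldots,m\}$ is intersecting if $A\cap B\neq\emptyset$ for all $A,B\in\mathcal{F}$. -}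

module Defs where

open import Data.Nat using (ℕ; zero; suc; _∸_; _^_)
open import Data.Fin using (Fin; _≟_)
open import Data.Fin.Subset using (Subset; inside; outside; _∈_; _∩_; Nonempty)
open import Data.Fin.Subset.Properties using (_∈?_; nonempty?)
open import Data.Fin.Properties using (any?; all?)
open import Data.Vec using ([]; _∷_)
open import Data.List using (List; []; _∷_; [_]; map; _++_; filter; length; allFin)
open import Data.Nat.ListAction using (sum; product)
open import Data.List.Relation.Unary.All using (All)
import Data.List.Relation.Unary.All as All
open import Data.Product using (∃; _×_; _,_)
open import Relation.Nullary using (¬_; Dec; yes; no)
open import Relation.Nullary.Decidable using (_×-dec_; _→-dec_; ¬?)
open import Relation.Binary.PropositionalEquality using (_≡_)

allSubsets : (n : ℕ) → List (Subset n)
allSubsets zero = [ [] ]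
allSubsets (suc n) = map (outside ∷_) (allSubsets n) ++ map (inside ∷_) (allSubsets n)

-- All sublists of a list; applied to a duplicate-free list of all subsets of
-- Fin m, these enumerate each family F ⊆ P({1..m}) exactly once.
sublists : ∀ {A : Set} → List A → List (List A)
sublists [] = [ [] ]
sublists (x ∷ xs) = sublists xs ++ map (x ∷_) (sublists xs)

NonemptyFamily : ∀ {m} → List (Subset m) → Set
NonemptyFamily F = ¬ (F ≡ [])

nonemptyFamily? : ∀ {m} (F : List (Subset m)) → Dec (NonemptyFamily F)
nonemptyFamily? [] = no (λ h → h _≡_.refl)
nonemptyFamily? (x ∷ F) = yes (λ ())

Intersecting : ∀ {m} → List (Subset m) → Set
Intersecting F = All (λ A → All (λ B → Nonempty (A ∩ B)) F) F

intersecting? : ∀ {m} (F : List (Subset m)) → Dec (Intersecting F)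
intersecting? F = All.all? (λ A → All.all? (λ B → nonempty? (A ∩ B)) F) F

module Cliques {n m : ℕ} (c : Fin m → Subset n) where

  InV : Fin n → Set
  InV v = ∃ λ j → v ∈ c j

  inV? : (v : Fin n) → Dec (InV v)
  inV? v = any? (λ j → v ∈? c j)

  Adjacent : Fin n → Fin n → Set
  Adjacent u v = ∃ λ j → (u ∈ c j × v ∈ c j)

  adjacent? : (u v : Fin n) → Dec (Adjacent u v)
  adjacent? u v = any? (λ j → (u ∈? c j) ×-dec (v ∈? c j))

  IsCliqueOfU : Subset n → Set
  IsCliqueOfU S = Nonempty S
                × (∀ v → v ∈ S → InV v)
                × (∀ u v → u ∈ S → v ∈ S → ¬ (u ≡ v) → Adjacent u v)

  isCliqueOfU? : (S : Subset n) → Dec (IsCliqueOfU S)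
  isCliqueOfU? S =
    nonempty? S
    ×-dec all? (λ v → (v ∈? S) →-dec inV? v)
    ×-dec all? (λ u → all? (λ v → (u ∈? S) →-dec ((v ∈? S) →-dec (¬? (u ≟ v) →-dec adjacent? u v))))

  numCliques : ℕ
  numCliques = length (filter isCliqueOfU? (allSubsets n))

  InΓ : Subset m → Fin n → Set
  InΓ J v = InV v × (∀ j → ((v ∈ c j → j ∈ J) × (j ∈ J → v ∈ c j)))

  inΓ? : (J : Subset m) (v : Fin n) → Dec (InΓ J v)
  inΓ? J v = inV? v ×-dec all? (λ j → ((v ∈? c j) →-dec (j ∈? J)) ×-dec ((j ∈? J) →-dec (v ∈? c j)))

  γ : Subset m → ℕ
  γ J = length (filter (inΓ? J) (allFin n))

  formula : ℕ
  formula = sum (map (λ F → product (map (λ J → 2 ^ γ J ∸ 1) F))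
                     (filter (λ F → nonemptyFamily? F ×-dec intersecting? F)
                             (sublists (allSubsets m))))

-- Label each vertex v by L(v) = {j : v ∈ c_j}. A vertex set S is a clique of U exactly when S is
-- nonempty and the labels of its vertices form an intersecting family (a label meets itself iff
-- its vertex lies in V). Grouping the cliques by the set F of labels they realise, the cliques
-- realising F arise by choosing a nonempty subset of Γ_J for every J ∈ F, and there are
-- Π_{J∈F} (2^{γ_J} − 1) such choices. This grouping works for any property of lists that only
-- depends on the set of their elements; it is proved by induction on the list of labels,
-- carrying the elements already chosen as a tail X.
module Submission where

open import Defs
open import Data.Nat using (ℕ; zero; suc; _+_; _*_; _∸_; _^_)
open import Data.Nat.Properties using (+-identityʳ; +-suc; *-zeroʳ; *-distribˡ-+; m^n>0)
open import Data.Nat.ListAction using (sum; product)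
open import Data.Nat.ListAction.Properties using (sum-++)
open import Data.Nat.Solver using (module +-*-Solver)
open import Data.Bool using (true; false)
import Data.Bool as Bool
open import Data.Fin using (Fin; zero; suc)
import Data.Fin as Fin
open import Data.Fin.Subset using (Subset; inside; outside; _∈_; _∩_; Nonempty)
open import Data.Fin.Subset.Properties using (x∈p∩q⁺; x∈p∩q⁻; ⊆-antisym)
open import Data.Vec using ([]; _∷_; lookup)
import Data.Vec as Vec
open import Data.Vec.Properties using (≡-dec; []=⇒lookup; lookup⇒[]=; lookup∘tabulate; ∷-injectiveʳ)
open import Data.List using (List; []; _∷_; map; _++_; filter; length; tabulate; allFin)
open import Data.List.Properties
  using (length-map; map-cong-local; length-++; filter-++; filter-≐; filter-accept; filter-reject; map-++; map-∘; map-tabulate; ++-identityʳ)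
import Data.List.Membership.Propositional as List
open import Data.List.Membership.Propositional.Properties using (∈-++⁺ˡ; ∈-++⁺ʳ; ∈-map⁺; ∈-map⁻)
open import Data.List.Relation.Binary.Subset.Propositional using (_⊆_)
open import Data.List.Relation.Binary.Subset.Propositional.Properties
  using (⊆-refl; ⊆-reflexive; ⊆-reflexive-↭; xs⊆x∷xs; ∈-∷⁺ʳ; ++⁺ʳ; ⊆[]⇒≡[]; All-resp-⊇)
open import Data.List.Relation.Binary.Permutation.Propositional using (↭-refl; ↭-sym; ↭-swap)
open import Data.List.Relation.Binary.Permutation.Propositional.Properties using (shift)
open import Data.List.Relation.Unary.Any using (here; there)
open import Data.List.Relation.Unary.All using (All; []; _∷_)
import Data.List.Relation.Unary.All as All
open import Data.List.Relation.Unary.All.Properties using (all-filter)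
open import Data.List.Relation.Unary.Unique.Propositional using (Unique)
open import Data.List.Relation.Unary.Unique.Propositional.Properties using (++⁺; map⁺)
import Data.List.Relation.Unary.AllPairs as AllPairs
open import Data.Product using (_×_; _,_; proj₁; proj₂)
open import Data.Empty using (⊥; ⊥-elim)
open import Relation.Nullary using (¬_; yes; no; does)
open import Relation.Nullary.Decidable using (_×-dec_)
open import Relation.Unary using (Decidable)
open import Function using (_∘_; _⇔_; mk⇔; Equivalence)
open import Relation.Binary.Definitions using (DecidableEquality)
open import Relation.Binary.PropositionalEquality

filter-map : ∀ {A B : Set} {P : B → Set} (P? : Decidable P) (g : A → B) (xs : List A) →
             filter P? (map g xs) ≡ map g (filter (λ x → P? (g x)) xs)
filter-map P? g [] = refl
filter-map P? g (x ∷ xs) with does (P? (g x))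
... | true = cong (g x ∷_) (filter-map P? g xs)
... | false = filter-map P? g xs

sum-map-product-∷ : ∀ {A : Set} (f : A → ℕ) (t : A) (Fs : List (List A)) →
                    sum (map (λ F → product (map f F)) (map (t ∷_) Fs))
                      ≡ f t * sum (map (λ F → product (map f F)) Fs)
sum-map-product-∷ f t [] = sym (*-zeroʳ (f t))
sum-map-product-∷ f t (F ∷ Fs) =
  trans (cong (f t * product (map f F) +_) (sum-map-product-∷ f t Fs))
        (sym (*-distribˡ-+ (f t) _ _))

2^suc∸1 : ∀ k → 2 ^ suc k ∸ 1 ≡ suc (2 * (2 ^ k ∸ 1))
2^suc∸1 k with 2 ^ k | m^n>0 2 k
... | suc p | _ = +-suc p (p + 0)

module SupportCounting {A : Set} (_≟_ : DecidableEquality A)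
       {P : List A → Set} (P? : Decidable P)
       (P-resp-⊆⊇ : ∀ {X Y} → X ⊆ Y → Y ⊆ X → P X → P Y) where

  multiplicity : A → List A → ℕ
  multiplicity t xs = length (filter (_≟ t) xs)

  weight : List A → A → ℕ
  weight xs t = 2 ^ multiplicity t xs ∸ 1

  P?-++ : (X : List A) → Decidable (λ S → P (S ++ X))
  P?-++ X S = P? (S ++ X)

  -- The tail X holds the elements already chosen: P is tested on S ++ X.
  countSublists : List A → List A → ℕ
  countSublists xs X = length (filter (P?-++ X) (sublists xs))

  weightedCount : List A → (A → ℕ) → List A → ℕ
  weightedCount T f X = sum (map (λ F → product (map f F)) (filter (P?-++ X) (sublists T)))

  filter-resp-⊆⊇ : (g h : List A → List A) → (∀ S → g S ⊆ h S) → (∀ S → h S ⊆ g S) →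
                   filter (λ S → P? (g S)) ≗ filter (λ S → P? (h S))
  filter-resp-⊆⊇ g h g⊆h h⊆g =
    filter-≐ _ _ ((λ {S} → P-resp-⊆⊇ (g⊆h S) (h⊆g S)) , (λ {S} → P-resp-⊆⊇ (h⊆g S) (g⊆h S)))

  filter-sublists-∷ : ∀ a xs X →
    filter (P?-++ X) (sublists (a ∷ xs))
      ≡ filter (P?-++ X) (sublists xs) ++ map (a ∷_) (filter (P?-++ (a ∷ X)) (sublists xs))
  filter-sublists-∷ a xs X = begin
    filter (P?-++ X) (sublists xs ++ map (a ∷_) (sublists xs))
      ≡⟨ filter-++ (P?-++ X) (sublists xs) _ ⟩
    filter (P?-++ X) (sublists xs) ++ filter (P?-++ X) (map (a ∷_) (sublists xs))
      ≡⟨ cong (filter (P?-++ X) (sublists xs) ++_) (filter-map (P?-++ X) (a ∷_) (sublists xs)) ⟩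
    filter (P?-++ X) (sublists xs) ++ map (a ∷_) (filter (λ S → P? (a ∷ S ++ X)) (sublists xs))
      ≡⟨ cong (λ Ss → filter (P?-++ X) (sublists xs) ++ map (a ∷_) Ss)
              (filter-resp-⊆⊇ (λ S → a ∷ S ++ X) (_++ a ∷ X)
                 (λ S → ⊆-reflexive-↭ (↭-sym (shift a S X))) (λ S → ⊆-reflexive-↭ (shift a S X))
                 (sublists xs)) ⟩
    filter (P?-++ X) (sublists xs) ++ map (a ∷_) (filter (P?-++ (a ∷ X)) (sublists xs)) ∎
    where open ≡-Reasoning

  countSublists-∷ : ∀ a xs X → countSublists (a ∷ xs) X ≡ countSublists xs X + countSublists xs (a ∷ X)
  countSublists-∷ a xs X = begin
    length (filter (P?-++ X) (sublists (a ∷ xs)))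
      ≡⟨ cong length (filter-sublists-∷ a xs X) ⟩
    length (filter (P?-++ X) (sublists xs) ++ map (a ∷_) (filter (P?-++ (a ∷ X)) (sublists xs)))
      ≡⟨ length-++ (filter (P?-++ X) (sublists xs)) ⟩
    countSublists xs X + length (map (a ∷_) (filter (P?-++ (a ∷ X)) (sublists xs)))
      ≡⟨ cong (countSublists xs X +_) (length-map (a ∷_) (filter (P?-++ (a ∷ X)) (sublists xs))) ⟩
    countSublists xs X + countSublists xs (a ∷ X) ∎
    where open ≡-Reasoning

  weightedCount-∷ : ∀ t T f X → weightedCount (t ∷ T) f X ≡ weightedCount T f X + f t * weightedCount T f (t ∷ X)
  weightedCount-∷ t T f X = begin
    sum (map h (filter (P?-++ X) (sublists (t ∷ T))))
      ≡⟨ cong (λ Fs → sum (map h Fs)) (filter-sublists-∷ t T X) ⟩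
    sum (map h (filter (P?-++ X) (sublists T) ++ map (t ∷_) (filter (P?-++ (t ∷ X)) (sublists T))))
      ≡⟨ cong sum (map-++ h (filter (P?-++ X) (sublists T)) _) ⟩
    sum (map h (filter (P?-++ X) (sublists T)) ++ map h (map (t ∷_) (filter (P?-++ (t ∷ X)) (sublists T))))
      ≡⟨ sum-++ (map h (filter (P?-++ X) (sublists T))) _ ⟩
    weightedCount T f X + sum (map h (map (t ∷_) (filter (P?-++ (t ∷ X)) (sublists T))))
      ≡⟨ cong (weightedCount T f X +_) (sum-map-product-∷ f t (filter (P?-++ (t ∷ X)) (sublists T))) ⟩
    weightedCount T f X + f t * weightedCount T f (t ∷ X) ∎
    where
    open ≡-Reasoning
    h : List A → ℕ
    h F = product (map f F)

  weightedCount-[] : ∀ f X → weightedCount [] f X ≡ countSublists [] X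
  weightedCount-[] f X with P? X
  ... | yes _ = refl
  ... | no _ = refl

  weightedCount-resp-⊆⊇ : ∀ T f {X Y} → X ⊆ Y → Y ⊆ X → weightedCount T f X ≡ weightedCount T f Y
  weightedCount-resp-⊆⊇ T f {X} {Y} X⊆Y Y⊆X =
    cong (λ Fs → sum (map (λ F → product (map f F)) Fs))
         (filter-resp-⊆⊇ (_++ X) (_++ Y) (λ S → ++⁺ʳ S X⊆Y) (λ S → ++⁺ʳ S Y⊆X) (sublists T))

  weightedCount-cong : ∀ T {f g} X → All (λ t → f t ≡ g t) T → weightedCount T f X ≡ weightedCount T g X
  weightedCount-cong [] {f} {g} X [] = trans (weightedCount-[] f X) (sym (weightedCount-[] g X))
  weightedCount-cong (t ∷ T) {f} {g} X (ft≡gt ∷ f≗g) = begin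
    weightedCount (t ∷ T) f X ≡⟨ weightedCount-∷ t T f X ⟩
    weightedCount T f X + f t * weightedCount T f (t ∷ X)
      ≡⟨ cong₂ _+_ (weightedCount-cong T X f≗g)
               (cong₂ _*_ ft≡gt (weightedCount-cong T (t ∷ X) f≗g)) ⟩
    weightedCount T g X + g t * weightedCount T g (t ∷ X) ≡⟨ weightedCount-∷ t T g X ⟨
    weightedCount (t ∷ T) g X ∎
    where open ≡-Reasoning

  weightedCount-zero : ∀ T X → weightedCount T (λ _ → 0) X ≡ countSublists [] X
  weightedCount-zero [] X = weightedCount-[] (λ _ → 0) X
  weightedCount-zero (t ∷ T) X =
    trans (weightedCount-∷ t T (λ _ → 0) X) (trans (+-identityʳ _) (weightedCount-zero T X))

  weight-∷-≢ : ∀ {a t} xs → a ≢ t → weight (a ∷ xs) t ≡ weight xs t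
  weight-∷-≢ {a} {t} xs a≢t = cong (λ k → 2 ^ length k ∸ 1) (filter-reject (_≟ t) a≢t)

  -- A nonempty subset of k + 1 copies is the new copy alone, or a nonempty subset of the
  -- old copies with or without the new one.
  weight-∷-self : ∀ a xs → weight (a ∷ xs) a ≡ suc (2 * weight xs a)
  weight-∷-self a xs =
    trans (cong (λ k → 2 ^ length k ∸ 1) (filter-accept (_≟ a) refl)) (2^suc∸1 (multiplicity a xs))

  private
    distrib-1+2* : ∀ u v w → u + suc (2 * w) * v ≡ (u + w * v) + (v + w * v)
    distrib-1+2* = solve 3 (λ u v w → u :+ (con 1 :+ con 2 :* w) :* v := (u :+ w :* v) :+ (v :+ w :* v)) refl
      where open +-*-Solver

    interchange : ∀ p q r s w → (p + q) + w * (r + s) ≡ (p + w * r) + (q + w * s)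
    interchange = solve 5 (λ p q r s w → (p :+ q) :+ w :* (r :+ s) := (p :+ w :* r) :+ (q :+ w :* s)) refl
      where open +-*-Solver

  weightedCount-weight-∷-head : ∀ a T xs X → All (a ≢_) T →
    weightedCount (a ∷ T) (weight (a ∷ xs)) X
      ≡ weightedCount (a ∷ T) (weight xs) X + weightedCount (a ∷ T) (weight xs) (a ∷ X)
  weightedCount-weight-∷-head a T xs X a∉T = begin
    weightedCount (a ∷ T) f′ X
      ≡⟨ weightedCount-∷ a T f′ X ⟩
    weightedCount T f′ X + f′ a * weightedCount T f′ (a ∷ X)
      ≡⟨ cong₂ _+_ (weightedCount-cong T X f′≗f)
                   (cong₂ _*_ (weight-∷-self a xs) (weightedCount-cong T (a ∷ X) f′≗f)) ⟩
    weightedCount T f X + suc (2 * f a) * weightedCount T f (a ∷ X)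
      ≡⟨ distrib-1+2* (weightedCount T f X) (weightedCount T f (a ∷ X)) (f a) ⟩
    (weightedCount T f X + f a * weightedCount T f (a ∷ X))
      + (weightedCount T f (a ∷ X) + f a * weightedCount T f (a ∷ X))
      ≡⟨ cong (λ k → (weightedCount T f X + f a * weightedCount T f (a ∷ X))
                       + (weightedCount T f (a ∷ X) + f a * k))
              (weightedCount-resp-⊆⊇ T f (xs⊆x∷xs (a ∷ X) a) (∈-∷⁺ʳ (here refl) ⊆-refl)) ⟩
    (weightedCount T f X + f a * weightedCount T f (a ∷ X))
      + (weightedCount T f (a ∷ X) + f a * weightedCount T f (a ∷ a ∷ X))
      ≡⟨ cong₂ _+_ (weightedCount-∷ a T f X) (weightedCount-∷ a T f (a ∷ X)) ⟨
    weightedCount (a ∷ T) f X + weightedCount (a ∷ T) f (a ∷ X) ∎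
    where
    open ≡-Reasoning
    f f′ : A → ℕ
    f = weight xs
    f′ = weight (a ∷ xs)
    f′≗f : All (λ t → f′ t ≡ f t) T
    f′≗f = All.map (weight-∷-≢ xs) a∉T

  weightedCount-weight-∷ : ∀ a T xs X → Unique T → a List.∈ T →
    weightedCount T (weight (a ∷ xs)) X ≡ weightedCount T (weight xs) X + weightedCount T (weight xs) (a ∷ X)
  weightedCount-weight-∷ a (a ∷ T) xs X (a∉T AllPairs.∷ _) (here refl) =
    weightedCount-weight-∷-head a T xs X a∉T
  weightedCount-weight-∷ a (t ∷ T) xs X (t∉T AllPairs.∷ T-unique) (there a∈T) = begin
    weightedCount (t ∷ T) f′ X
      ≡⟨ weightedCount-∷ t T f′ X ⟩
    weightedCount T f′ X + f′ t * weightedCount T f′ (t ∷ X)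
      ≡⟨ cong₂ _+_ (weightedCount-weight-∷ a T xs X T-unique a∈T)
                   (cong₂ _*_ (weight-∷-≢ xs (λ a≡t → All.lookup t∉T a∈T (sym a≡t)))
                              (weightedCount-weight-∷ a T xs (t ∷ X) T-unique a∈T)) ⟩
    (weightedCount T f X + weightedCount T f (a ∷ X))
      + f t * (weightedCount T f (t ∷ X) + weightedCount T f (a ∷ t ∷ X))
      ≡⟨ interchange (weightedCount T f X) (weightedCount T f (a ∷ X))
                     (weightedCount T f (t ∷ X)) (weightedCount T f (a ∷ t ∷ X)) (f t) ⟩
    (weightedCount T f X + f t * weightedCount T f (t ∷ X))
      + (weightedCount T f (a ∷ X) + f t * weightedCount T f (a ∷ t ∷ X))
      ≡⟨ cong (λ k → (weightedCount T f X + f t * weightedCount T f (t ∷ X))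
                       + (weightedCount T f (a ∷ X) + f t * k))
              (weightedCount-resp-⊆⊇ T f (⊆-reflexive-↭ (↭-swap a t ↭-refl))
                                          (⊆-reflexive-↭ (↭-swap t a ↭-refl))) ⟩
    (weightedCount T f X + f t * weightedCount T f (t ∷ X))
      + (weightedCount T f (a ∷ X) + f t * weightedCount T f (t ∷ a ∷ X))
      ≡⟨ cong₂ _+_ (weightedCount-∷ t T f X) (weightedCount-∷ t T f (a ∷ X)) ⟨
    weightedCount (t ∷ T) f X + weightedCount (t ∷ T) f (a ∷ X) ∎
    where
    open ≡-Reasoning
    f f′ : A → ℕ
    f = weight xs
    f′ = weight (a ∷ xs)

  countSublists≡weightedCount : ∀ T → Unique T → ∀ xs → All (List._∈ T) xs → ∀ X →
                                countSublists xs X ≡ weightedCount T (weight xs) X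
  countSublists≡weightedCount T T-unique [] [] X = sym (weightedCount-zero T X)
  countSublists≡weightedCount T T-unique (a ∷ xs) (a∈T ∷ xs⊆T) X = begin
    countSublists (a ∷ xs) X                                 ≡⟨ countSublists-∷ a xs X ⟩
    countSublists xs X + countSublists xs (a ∷ X)
      ≡⟨ cong₂ _+_ (countSublists≡weightedCount T T-unique xs xs⊆T X)
                   (countSublists≡weightedCount T T-unique xs xs⊆T (a ∷ X)) ⟩
    weightedCount T (weight xs) X + weightedCount T (weight xs) (a ∷ X)
      ≡⟨ weightedCount-weight-∷ a T xs X T-unique a∈T ⟨
    weightedCount T (weight (a ∷ xs)) X ∎
    where open ≡-Reasoning

  length-filter-sublists : ∀ T → Unique T → ∀ xs → All (List._∈ T) xs →
    length (filter P? (sublists xs)) ≡ sum (map (λ F → product (map (weight xs) F)) (filter P? (sublists T)))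
  length-filter-sublists T T-unique xs xs⊆T = begin
    length (filter P? (sublists xs))
      ≡⟨ cong length (drop-++[] (sublists xs)) ⟩
    countSublists xs []
      ≡⟨ countSublists≡weightedCount T T-unique xs xs⊆T [] ⟩
    weightedCount T (weight xs) []
      ≡⟨ cong (λ Fs → sum (map (λ F → product (map (weight xs) F)) Fs)) (drop-++[] (sublists T)) ⟨
    sum (map (λ F → product (map (weight xs) F)) (filter P? (sublists T))) ∎
    where
    open ≡-Reasoning
    drop-++[] : filter P? ≗ filter (P?-++ [])
    drop-++[] = filter-resp-⊆⊇ (λ S → S) (_++ [])
                  (λ S → ⊆-reflexive (sym (++-identityʳ S))) (λ S → ⊆-reflexive (++-identityʳ S))

∈-allSubsets : ∀ {m} (x : Subset m) → x List.∈ allSubsets m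
∈-allSubsets [] = here refl
∈-allSubsets (outside ∷ x) = ∈-++⁺ˡ (∈-map⁺ (outside ∷_) (∈-allSubsets x))
∈-allSubsets {suc m} (inside ∷ x) = ∈-++⁺ʳ (map (outside ∷_) (allSubsets m)) (∈-map⁺ (inside ∷_) (∈-allSubsets x))

allSubsets-unique : ∀ m → Unique (allSubsets m)
allSubsets-unique zero = [] AllPairs.∷ AllPairs.[]
allSubsets-unique (suc m) =
  ++⁺ (map⁺ ∷-injectiveʳ (allSubsets-unique m)) (map⁺ ∷-injectiveʳ (allSubsets-unique m)) disjoint
  where
  disjoint : ∀ {x} → ¬ (x List.∈ map (outside ∷_) (allSubsets m) × x List.∈ map (inside ∷_) (allSubsets m))
  disjoint (x∈out , x∈in) with ∈-map⁻ (outside ∷_) x∈out | ∈-map⁻ (inside ∷_) x∈in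
  ... | _ , _ , refl | _ , _ , ()

select : ∀ {n} {A : Set} → Subset n → (Fin n → A) → List A
select [] g = []
select (inside ∷ S) g = g zero ∷ select S (g ∘ suc)
select (outside ∷ S) g = select S (g ∘ suc)

map-select-allSubsets : ∀ n {A : Set} (g : Fin n → A) →
                        map (λ S → select S g) (allSubsets n) ≡ sublists (tabulate g)
map-select-allSubsets zero g = refl
map-select-allSubsets (suc n) g = begin
  map (λ S → select S g) (map (outside ∷_) (allSubsets n) ++ map (inside ∷_) (allSubsets n))
    ≡⟨ map-++ (λ S → select S g) (map (outside ∷_) (allSubsets n)) _ ⟩
  map (λ S → select S g) (map (outside ∷_) (allSubsets n))
    ++ map (λ S → select S g) (map (inside ∷_) (allSubsets n))
    ≡⟨ cong₂ _++_ (map-∘ (allSubsets n)) (map-∘ (allSubsets n)) ⟨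
  map (λ S → select S (g ∘ suc)) (allSubsets n) ++ map (λ S → g zero ∷ select S (g ∘ suc)) (allSubsets n)
    ≡⟨ cong (map (λ S → select S (g ∘ suc)) (allSubsets n) ++_) (map-∘ (allSubsets n)) ⟩
  map (λ S → select S (g ∘ suc)) (allSubsets n) ++ map (g zero ∷_) (map (λ S → select S (g ∘ suc)) (allSubsets n))
    ≡⟨ cong (λ Ss → Ss ++ map (g zero ∷_) Ss) (map-select-allSubsets n (g ∘ suc)) ⟩
  sublists (tabulate (g ∘ suc)) ++ map (g zero ∷_) (sublists (tabulate (g ∘ suc))) ∎
  where open ≡-Reasoning

module _ {A : Set} {P : A → Set} where

  All-select⁺ : ∀ {n} (S : Subset n) (g : Fin n → A) → (∀ v → v ∈ S → P (g v)) → All P (select S g)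
  All-select⁺ [] g h = []
  All-select⁺ (inside ∷ S) g h = h zero Vec.here ∷ All-select⁺ S (g ∘ suc) (λ v v∈S → h (suc v) (Vec.there v∈S))
  All-select⁺ (outside ∷ S) g h = All-select⁺ S (g ∘ suc) (λ v v∈S → h (suc v) (Vec.there v∈S))

  All-select⁻ : ∀ {n} (S : Subset n) (g : Fin n → A) → All P (select S g) → ∀ v → v ∈ S → P (g v)
  All-select⁻ (inside ∷ S) g (p ∷ ps) zero Vec.here = p
  All-select⁻ (inside ∷ S) g (p ∷ ps) (suc v) (Vec.there v∈S) = All-select⁻ S (g ∘ suc) ps v v∈S
  All-select⁻ (outside ∷ S) g ps (suc v) (Vec.there v∈S) = All-select⁻ S (g ∘ suc) ps v v∈S

module _ {A : Set} where

  Nonempty⇒select≢[] : ∀ {n} (S : Subset n) (g : Fin n → A) → Nonempty S → select S g ≢ []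
  Nonempty⇒select≢[] S g (v , v∈S) eq = All-select⁻ S g (subst (All (λ _ → ⊥)) (sym eq) []) v v∈S

  select≢[]⇒Nonempty : ∀ {n} (S : Subset n) (g : Fin n → A) → select S g ≢ [] → Nonempty S
  select≢[]⇒Nonempty [] g ne = ⊥-elim (ne refl)
  select≢[]⇒Nonempty (inside ∷ S) g ne = zero , Vec.here
  select≢[]⇒Nonempty (outside ∷ S) g ne with select≢[]⇒Nonempty S (g ∘ suc) ne
  ... | v , v∈S = suc v , Vec.there v∈S

module _ {m : ℕ} where

  NonemptyIntersecting : List (Subset m) → Set
  NonemptyIntersecting F = NonemptyFamily F × Intersecting F

  nonemptyIntersecting? : Decidable NonemptyIntersecting
  nonemptyIntersecting? F = nonemptyFamily? F ×-dec intersecting? F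

  nonemptyIntersecting-resp-⊆⊇ : ∀ {X Y} → X ⊆ Y → Y ⊆ X → NonemptyIntersecting X → NonemptyIntersecting Y
  nonemptyIntersecting-resp-⊆⊇ X⊆Y Y⊆X (X≢[] , X-intersecting) =
    (λ { refl → X≢[] (⊆[]⇒≡[] X⊆Y) }) ,
    All-resp-⊇ Y⊆X (All.map (All-resp-⊇ Y⊆X) X-intersecting)

  Intersecting⇒Nonempty : ∀ {F : List (Subset m)} {J} → Intersecting F → J List.∈ F → Nonempty J
  Intersecting⇒Nonempty {J = J} F-intersecting J∈F with All.lookup (All.lookup F-intersecting J∈F) J∈F
  ... | j , j∈J∩J = j , proj₁ (x∈p∩q⁻ J J j∈J∩J)

module CliqueLabels {n m : ℕ} (c : Fin m → Subset n) where
  open Cliques c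

  _≟_ : DecidableEquality (Subset m)
  _≟_ = ≡-dec Bool._≟_

  open SupportCounting _≟_ nonemptyIntersecting? nonemptyIntersecting-resp-⊆⊇ public

  label : Fin n → Subset m
  label v = Vec.tabulate (λ j → lookup (c j) v)

  labels : List (Subset m)
  labels = tabulate label

  label⁻ : ∀ {v j} → j ∈ label v → v ∈ c j
  label⁻ {v} {j} j∈ = lookup⇒[]= v (c j) (trans (sym (lookup∘tabulate (λ j → lookup (c j) v) j)) ([]=⇒lookup j∈))

  label⁺ : ∀ {v j} → v ∈ c j → j ∈ label v
  label⁺ {v} {j} v∈ = lookup⇒[]= j (label v) (trans (lookup∘tabulate (λ j → lookup (c j) v) j) ([]=⇒lookup v∈))

  Adjacent⇒labels-meet : ∀ {u v} → Adjacent u v → Nonempty (label u ∩ label v)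
  Adjacent⇒labels-meet (j , u∈ , v∈) = j , x∈p∩q⁺ (label⁺ u∈ , label⁺ v∈)

  labels-meet⇒Adjacent : ∀ {u v} → Nonempty (label u ∩ label v) → Adjacent u v
  labels-meet⇒Adjacent {u} {v} (j , j∈) with x∈p∩q⁻ (label u) (label v) j∈
  ... | j∈u , j∈v = j , label⁻ j∈u , label⁻ j∈v

  IsCliqueOfU⇒NonemptyIntersecting : ∀ S → IsCliqueOfU S → NonemptyIntersecting (select S label)
  IsCliqueOfU⇒NonemptyIntersecting S (S≢∅ , S⊆V , S-adjacent) =
    Nonempty⇒select≢[] S label S≢∅ ,
    All-select⁺ S label (λ u u∈S → All-select⁺ S label (λ v v∈S → Adjacent⇒labels-meet (adjacent u v u∈S v∈S)))
    where
    adjacent : ∀ u v → u ∈ S → v ∈ S → Adjacent u v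
    adjacent u v u∈S v∈S with u Fin.≟ v
    ... | yes refl = let j , u∈cj = S⊆V u u∈S in j , u∈cj , u∈cj
    ... | no u≢v = S-adjacent u v u∈S v∈S u≢v

  NonemptyIntersecting⇒IsCliqueOfU : ∀ S → NonemptyIntersecting (select S label) → IsCliqueOfU S
  NonemptyIntersecting⇒IsCliqueOfU S (select≢[] , labels-intersecting) =
    select≢[]⇒Nonempty S label select≢[] ,
    (λ v v∈S → let j , v∈cj , _ = adjacent v v v∈S v∈S in j , v∈cj) ,
    (λ u v u∈S v∈S _ → adjacent u v u∈S v∈S)
    where
    adjacent : ∀ u v → u ∈ S → v ∈ S → Adjacent u v
    adjacent u v u∈S v∈S =
      labels-meet⇒Adjacent (All-select⁻ S label (All-select⁻ S label labels-intersecting u u∈S) v v∈S)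

  numCliques≡#nonemptyIntersectingSublists : numCliques ≡ length (filter nonemptyIntersecting? (sublists labels))
  numCliques≡#nonemptyIntersectingSublists = begin
    length (filter isCliqueOfU? (allSubsets n))
      ≡⟨ cong length (filter-≐ isCliqueOfU? (nonemptyIntersecting? ∘ selectLabels)
                       ((λ {S} → IsCliqueOfU⇒NonemptyIntersecting S) , (λ {S} → NonemptyIntersecting⇒IsCliqueOfU S))
                       (allSubsets n)) ⟩
    length (filter (nonemptyIntersecting? ∘ selectLabels) (allSubsets n))
      ≡⟨ length-map selectLabels (filter (nonemptyIntersecting? ∘ selectLabels) (allSubsets n)) ⟨
    length (map selectLabels (filter (nonemptyIntersecting? ∘ selectLabels) (allSubsets n)))
      ≡⟨ cong length (filter-map nonemptyIntersecting? selectLabels (allSubsets n)) ⟨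
    length (filter nonemptyIntersecting? (map selectLabels (allSubsets n)))
      ≡⟨ cong (length ∘ filter nonemptyIntersecting?) (map-select-allSubsets n label) ⟩
    length (filter nonemptyIntersecting? (sublists labels)) ∎
    where
    open ≡-Reasoning
    selectLabels : Subset n → List (Subset m)
    selectLabels S = select S label

  InΓ⇔label≡ : ∀ {J} → Nonempty J → ∀ v → InΓ J v ⇔ label v ≡ J
  InΓ⇔label≡ {J} (j , j∈J) v = mk⇔
    (λ (_ , v-in-exactly-J) → ⊆-antisym (λ k∈ → proj₁ (v-in-exactly-J _) (label⁻ k∈))
                                        (λ k∈ → label⁺ (proj₂ (v-in-exactly-J _) k∈)))
    (λ { refl → (j , label⁻ j∈J) , λ k → label⁺ , label⁻ })

  γ≡multiplicity : ∀ {J} → Nonempty J → γ J ≡ multiplicity J labels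
  γ≡multiplicity {J} J≢∅ = begin
    length (filter (inΓ? J) (allFin n))
      ≡⟨ cong length (filter-≐ (inΓ? J) (λ v → label v ≟ J)
                       ((λ {v} → Equivalence.to (InΓ⇔label≡ J≢∅ v)) , (λ {v} → Equivalence.from (InΓ⇔label≡ J≢∅ v)))
                       (allFin n)) ⟩
    length (filter (λ v → label v ≟ J) (allFin n))
      ≡⟨ length-map label (filter (λ v → label v ≟ J) (allFin n)) ⟨
    length (map label (filter (λ v → label v ≟ J) (allFin n)))
      ≡⟨ cong length (filter-map (_≟ J) label (allFin n)) ⟨
    length (filter (_≟ J) (map label (allFin n)))
      ≡⟨ cong (length ∘ filter (_≟ J)) (map-tabulate (λ v → v) label) ⟩
    multiplicity J labels ∎
    where open ≡-Reasoning

  formula≡weightedSum :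
    formula ≡ sum (map (λ F → product (map (weight labels) F)) (filter nonemptyIntersecting? (sublists (allSubsets m))))
  formula≡weightedSum =
    cong sum (map-cong-local (All.map (λ (_ , F-intersecting) → cong product (map-cong-local
      (All.tabulate (λ J∈F → cong (λ k → 2 ^ k ∸ 1) (γ≡multiplicity (Intersecting⇒Nonempty F-intersecting J∈F))))))
      (all-filter nonemptyIntersecting? (sublists (allSubsets m)))))

corollary5p5 : (n m : ℕ) (c : Fin m → Subset n) →
    Cliques.numCliques c ≡ Cliques.formula c
corollary5p5 n m c = begin
  numCliques                                                 ≡⟨ numCliques≡#nonemptyIntersectingSublists ⟩
  length (filter nonemptyIntersecting? (sublists labels))
    ≡⟨ length-filter-sublists (allSubsets m) (allSubsets-unique m) labels (All.tabulate (λ {x} _ → ∈-allSubsets x)) ⟩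
  sum (map (λ F → product (map (weight labels) F)) (filter nonemptyIntersecting? (sublists (allSubsets m))))
    ≡⟨ formula≡weightedSum ⟨
  formula ∎
  where
  open ≡-Reasoning
  open Cliques c
  open CliqueLabels c
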